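{- Let $q>1$ and $n\geq 1$ be integers. In the New Hats-on-a-line Game with $q$ hat colours and $n$ players, the Gray Strategy succeeds (i.e., the players win) with probability exactly $1-\left(\frac{q-1}{q}\right)^{n}$.
   Context: The New Hats-on-a-line Game with $q$ hat colours and $n$ players: players $P_1,\dots,P_n$ stand in a line. Each player receives a hat whose colour is chosen uniformly at random from a fixed set of $q$ colours, independently of the other hats; one of the colours is called "gray". Player $P_i$ sees exactly the hats of $P_{i+1},\dots,P_n$ (not his own, nor those of $P_1,\dots,P_{i-1}$). The players respond one at a time in the order $P_1,P_2,\dots,P_n$; each response is either a guess of the player's own hat colour or a pass, and every player hears all earlier responses. Apart from agreeing on a strategy beforehand, no communication is allowed. The players win if at least one player guesses correctly and no player guesses incorrectly. The Gray Strategy: each player $P_i$, on his turn, passes if he sees at least one gray hat among the hats of $P_{i+1},\dots,P_n$, and otherwise guesses "gray". -}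

module Defs where

open import Data.Nat using (ℕ; zero; suc; _^_; NonZero)
open import Data.Nat.Properties using (m^n≢0)
open import Data.Fin using (Fin)
open import Data.Fin.Properties using (_≟_)
open import Data.Vec using (Vec; []; _∷_)
open import Data.List using (List; []; _∷_; _++_; [_]; map; concatMap; length; filter; allFin)
open import Data.Bool using (Bool; true; false; _∧_; _∨_; not; if_then_else_; T)
open import Data.Integer using (+_)
open import Data.Rational using (ℚ; _/_; _*_; 1ℚ)
open import Relation.Nullary.Decidable using (⌊_⌋; does)
open import Data.Bool.Properties using (T?)

-- A hat assignment for n players is a vector h : Vec (Fin q) n whose
-- i-th entry (from the front) is the hat of player P_{i+1}.
-- Player P_i sees exactly the hats of P_{i+1},…,P_n, i.e. the tail of
-- the vector behind his own entry, and hears all earlier responses.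

data Response (q : ℕ) : Set where
  pass  : Response q
  guess : Fin q → Response q

-- A (general, deterministic) strategy: given the player's index
-- (0-based position in the line), the list of hats he sees
-- (those of the players after him, in order) and the list of earlier
-- responses (in order P_1, …, P_{i-1}), produce a response.
Strategy : ℕ → Set
Strategy q = ℕ → List (Fin q) → List (Response q) → Response q

toList : ∀ {A : Set} {n} → Vec A n → List A
toList []       = []
toList (x ∷ xs) = x ∷ toList xs

-- Arguments: strategy, index of the current player, hats of the current
-- player and all players behind him, the history of earlier responses.
play : ∀ {q} → Strategy q → ℕ → List (Fin q) → List (Response q) → List (Response q)
play s i []       hist = []
play s i (c ∷ cs) hist = r ∷ play s (suc i) cs (hist ++ [ r ])
  where r = s i cs hist

correct : ∀ {q} → Fin q → Response q → Bool
correct c pass      = false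
correct c (guess d) = ⌊ c ≟ d ⌋

incorrect : ∀ {q} → Fin q → Response q → Bool
incorrect c pass      = false
incorrect c (guess d) = not ⌊ c ≟ d ⌋

anyCorrect : ∀ {q} → List (Fin q) → List (Response q) → Bool
anyCorrect (c ∷ cs) (r ∷ rs) = correct c r ∨ anyCorrect cs rs
anyCorrect _        _        = false

anyIncorrect : ∀ {q} → List (Fin q) → List (Response q) → Bool
anyIncorrect (c ∷ cs) (r ∷ rs) = incorrect c r ∨ anyIncorrect cs rs
anyIncorrect _        _        = false

wins : ∀ {q n} → Strategy q → Vec (Fin q) n → Bool
wins s h = anyCorrect hs rs ∧ not (anyIncorrect hs rs)
  where
    hs = toList h
    rs = play s 0 hs []

-- READING: a player who has heard an earlier guess also passes
-- (the game is effectively decided by the first guess); without this the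
-- last player always guesses gray and the winning probability would be 1/q.
containsColour : ∀ {q} → Fin q → List (Fin q) → Bool
containsColour g []       = false
containsColour g (c ∷ cs) = ⌊ c ≟ g ⌋ ∨ containsColour g cs

grayStrategy : ∀ {q} → Fin q → Strategy q
someGuess : ∀ {q} → List (Response q) → Bool
someGuess []              = false
someGuess (pass    ∷ rs)  = someGuess rs
someGuess (guess _ ∷ rs)  = true

grayStrategy g i seen heard =
  if containsColour g seen ∨ someGuess heard then pass else guess g

allVecs : ∀ q n → List (Vec (Fin q) n)
allVecs q zero    = [] ∷ []
allVecs q (suc n) = concatMap (λ c → map (c ∷_) (allVecs q n)) (allFin q)

count : ∀ {A : Set} → (A → Bool) → List A → ℕ
count p []       = 0
count p (x ∷ xs) = if p x then suc (count p xs) else count p xs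

prob : ∀ q n .{{_ : NonZero q}} → (Vec (Fin q) n → Bool) → ℚ
prob q n E = (+ count E (allVecs q n)) / (q ^ n)
  where instance _ = m^n≢0 q n

_^ℚ_ : ℚ → ℕ → ℚ
x ^ℚ zero  = 1ℚ
x ^ℚ suc n = x * (x ^ℚ n)

-- Under the Gray Strategy the first player who sees no gray hat guesses
-- gray, and every later player, having heard a guess, passes.  If some hat
-- is gray, that player is the one wearing the last gray hat, so the only
-- guess is correct; if none is, the last player guesses wrong.  Hence the
-- players lose exactly on the (q − 1)ⁿ gray-free assignments out of qⁿ.
module Submission where

open import Defs
open import Data.Nat using (ℕ; zero; suc; _+_; _*_; _^_; _∸_; _<_; _≤_; NonZero)
open import Data.Nat.Properties using (+-suc; m+n∸m≡n; m*n≢0; m^n≢0)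
open import Data.Fin using (Fin; zero; suc)
open import Data.Fin.Properties using (_≟_)
open import Data.Vec using (Vec; []; _∷_)
open import Data.List using (List; []; _∷_; _++_; [_]; map; concatMap; length; allFin)
open import Data.Bool.ListAction using (all)
open import Data.List.Properties using (length-tabulate; map-tabulate)
open import Data.Bool using (Bool; true; false; _∧_; _∨_; not)
open import Data.Bool.Properties using (∨-zeroʳ)
open import Data.Integer using (ℤ; +_)
import Data.Integer as ℤ
import Data.Integer.Properties as ℤ
open import Data.Integer.Tactic.RingSolver using (solve-∀)
open import Data.Rational using (_/_; _-_; 1ℚ; toℚᵘ)
import Data.Rational as ℚ
open import Data.Rational.Properties using (toℚᵘ-injective; toℚᵘ-fromℚᵘ; toℚᵘ-homo-*; toℚᵘ-homo-+; toℚᵘ-homo‿-)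
open import Data.Rational.Unnormalised as ℚᵘ using (mkℚᵘ; 1ℚᵘ; _≃_; *≡*)
import Data.Rational.Unnormalised.Properties as ℚᵘ
open import Function using (_∘_)
open import Relation.Nullary.Decidable using (⌊_⌋; yes; no)
open import Relation.Binary.PropositionalEquality using (_≡_; refl; sym; trans; cong; cong₂; subst; module ≡-Reasoning)

module GrayStrategy {q : ℕ} (g : Fin q) where

  winning : List (Fin q) → List (Response q) → Bool
  winning cs rs = anyCorrect cs rs ∧ not (anyIncorrect cs rs)

  passes : List (Fin q) → List (Response q)
  passes = map (λ _ → pass)

  someGuess-++-pass : ∀ (rs : List (Response q)) → someGuess (rs ++ [ pass ]) ≡ someGuess rs
  someGuess-++-pass []             = refl
  someGuess-++-pass (pass ∷ rs)    = someGuess-++-pass rs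
  someGuess-++-pass (guess _ ∷ rs) = refl

  someGuess-++-guess : ∀ (rs : List (Response q)) d → someGuess (rs ++ [ guess d ]) ≡ true
  someGuess-++-guess []             d = refl
  someGuess-++-guess (pass ∷ rs)    d = someGuess-++-guess rs d
  someGuess-++-guess (guess _ ∷ rs) d = refl

  play-after-guess : ∀ i cs hist → someGuess hist ≡ true →
                     play (grayStrategy g) i cs hist ≡ passes cs
  play-after-guess i []       hist heard = refl
  play-after-guess i (c ∷ cs) hist heard rewrite heard | ∨-zeroʳ (containsColour g cs) =
    cong (pass ∷_) (play-after-guess (suc i) cs (hist ++ [ pass ])
                     (trans (someGuess-++-pass hist) heard))

  anyCorrect-passes : ∀ cs → anyCorrect cs (passes cs) ≡ false
  anyCorrect-passes []       = refl
  anyCorrect-passes (_ ∷ cs) = anyCorrect-passes cs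

  anyIncorrect-passes : ∀ cs → anyIncorrect cs (passes cs) ≡ false
  anyIncorrect-passes []       = refl
  anyIncorrect-passes (_ ∷ cs) = anyIncorrect-passes cs

  winning-guess-passes : ∀ c d cs → winning (c ∷ cs) (guess d ∷ passes cs) ≡ ⌊ c ≟ d ⌋ ∨ false
  winning-guess-passes c d cs rewrite anyCorrect-passes cs | anyIncorrect-passes cs with c ≟ d
  ... | yes _ = refl
  ... | no  _ = refl

  winning-play : ∀ i cs hist → someGuess hist ≡ false →
                 winning cs (play (grayStrategy g) i cs hist) ≡ containsColour g cs
  winning-play i []       hist silent = refl
  winning-play i (c ∷ cs) hist silent rewrite silent with containsColour g cs in sees
  ... | true  = trans (winning-play (suc i) cs (hist ++ [ pass ])
                        (trans (someGuess-++-pass hist) silent))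
                      (trans sees (sym (∨-zeroʳ ⌊ c ≟ g ⌋)))
  ... | false rewrite play-after-guess (suc i) cs (hist ++ [ guess g ]) (someGuess-++-guess hist g) =
    winning-guess-passes c g cs

  wins-grayStrategy : ∀ {n} (h : Vec (Fin q) n) → wins (grayStrategy g) h ≡ containsColour g (toList h)
  wins-grayStrategy h = winning-play 0 (toList h) [] refl

module _ {A : Set} where

  count-ext : ∀ {p p′ : A → Bool} → (∀ x → p x ≡ p′ x) → ∀ xs → count p xs ≡ count p′ xs
  count-ext            eq []       = refl
  count-ext {p′ = p′} eq (x ∷ xs) rewrite eq x with p′ x
  ... | true  = cong suc (count-ext eq xs)
  ... | false = count-ext eq xs

  count-false : ∀ (xs : List A) → count (λ _ → false) xs ≡ 0
  count-false []       = refl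
  count-false (_ ∷ xs) = count-false xs

  count-true : ∀ (xs : List A) → count (λ _ → true) xs ≡ length xs
  count-true []       = refl
  count-true (_ ∷ xs) = cong suc (count-true xs)

  count-++ : ∀ (p : A → Bool) xs ys → count p (xs ++ ys) ≡ count p xs + count p ys
  count-++ p []       ys = refl
  count-++ p (x ∷ xs) ys with p x
  ... | true  = cong suc (count-++ p xs ys)
  ... | false = count-++ p xs ys

  count-+-count-not : ∀ (p : A → Bool) xs → count p xs + count (not ∘ p) xs ≡ length xs
  count-+-count-not p []       = refl
  count-+-count-not p (x ∷ xs) with p x
  ... | true  = cong suc (count-+-count-not p xs)
  ... | false = trans (+-suc _ _) (cong suc (count-+-count-not p xs))

count-map : ∀ {A B : Set} (p : B → Bool) (f : A → B) xs → count p (map f xs) ≡ count (p ∘ f) xs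
count-map p f []       = refl
count-map p f (x ∷ xs) with p (f x)
... | true  = cong suc (count-map p f xs)
... | false = count-map p f xs

count-concatMap-product : ∀ {A B C : Set} (f : A → B → C) (p : C → Bool) (a : A → Bool) (b : B → Bool) →
                          (∀ x y → p (f x y) ≡ a x ∧ b y) → ∀ xs ys →
                          count p (concatMap (λ x → map (f x) ys) xs) ≡ count a xs * count b ys
count-concatMap-product f p a b split []       ys = refl
count-concatMap-product f p a b split (x ∷ xs) ys
  rewrite count-++ p (map (f x) ys) (concatMap (λ x → map (f x) ys) xs)
        | count-map p (f x) ys
        | count-ext (split x) ys
        | count-concatMap-product f p a b split xs ys
  with a x
... | true  = refl
... | false = cong (_+ count a xs * count b ys) (count-false ys)

count-all-allVecs : ∀ {q} (b : Fin q → Bool) n →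
                    count (all b ∘ toList) (allVecs q n) ≡ count b (allFin q) ^ n
count-all-allVecs         b zero    = refl
count-all-allVecs {q = q} b (suc n) =
  trans (count-concatMap-product _∷_ all-b b all-b (λ _ _ → refl) (allFin q) (allVecs q n))
        (cong (count b (allFin q) *_) (count-all-allVecs b n))
  where
    all-b : ∀ {k} → Vec (Fin q) k → Bool
    all-b = all b ∘ toList

all-true : ∀ {A : Set} (xs : List A) → all (λ _ → true) xs ≡ true
all-true []       = refl
all-true (_ ∷ xs) = all-true xs

length-allVecs : ∀ q n → length (allVecs q n) ≡ q ^ n
length-allVecs q n = begin
  length (allVecs q n)                                ≡⟨ sym (count-true (allVecs q n)) ⟩
  count (λ _ → true) (allVecs q n)                    ≡⟨ count-ext (sym ∘ all-true ∘ toList) (allVecs q n) ⟩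
  count (all (λ _ → true) ∘ toList) (allVecs q n)     ≡⟨ count-all-allVecs (λ _ → true) n ⟩
  count (λ _ → true) (allFin q) ^ n                   ≡⟨ cong (_^ n) (count-true (allFin q)) ⟩
  length (allFin q) ^ n                               ≡⟨ cong (_^ n) (length-tabulate (λ i → i)) ⟩
  q ^ n                                               ∎
  where open ≡-Reasoning

isYes-suc≟suc : ∀ {q} (i j : Fin q) → ⌊ suc i ≟ suc j ⌋ ≡ ⌊ i ≟ j ⌋
isYes-suc≟suc i j with i ≟ j
... | yes _ = refl
... | no  _ = refl

allFin-suc : ∀ q → allFin (suc q) ≡ zero ∷ map suc (allFin q)
allFin-suc q = cong (zero ∷_) (sym (map-tabulate (λ i → i) suc))

count-≟-allFin : ∀ {q} (g : Fin q) → count (λ c → ⌊ c ≟ g ⌋) (allFin q) ≡ 1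
count-≟-allFin {suc q} zero    = trans (cong (count is-zero) (allFin-suc q))
  (cong suc (trans (count-map is-zero suc (allFin q)) (count-false (allFin q))))
  where
    is-zero : Fin (suc q) → Bool
    is-zero c = ⌊ c ≟ zero ⌋
count-≟-allFin {suc q} (suc g) = trans (cong (count is-suc-g) (allFin-suc q))
  (trans (count-map is-suc-g suc (allFin q))
         (trans (count-ext (λ i → isYes-suc≟suc i g) (allFin q)) (count-≟-allFin g)))
  where
    is-suc-g : Fin (suc q) → Bool
    is-suc-g c = ⌊ c ≟ suc g ⌋

count-≢-allFin : ∀ {q} (g : Fin q) → count (λ c → not ⌊ c ≟ g ⌋) (allFin q) ≡ q ∸ 1
count-≢-allFin {q} g = begin
  others                                ≡⟨ sym (m+n∸m≡n 1 others) ⟩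
  1 + others ∸ 1                        ≡⟨ cong (λ k → k + others ∸ 1) (sym (count-≟-allFin g)) ⟩
  count is-g (allFin q) + others ∸ 1    ≡⟨ cong (_∸ 1) (count-+-count-not is-g (allFin q)) ⟩
  length (allFin q) ∸ 1                 ≡⟨ cong (_∸ 1) (length-tabulate {n = q} (λ i → i)) ⟩
  q ∸ 1                                 ∎
  where
    open ≡-Reasoning
    is-g : Fin q → Bool
    is-g c = ⌊ c ≟ g ⌋
    others : ℕ
    others = count (not ∘ is-g) (allFin q)

not-containsColour : ∀ {q} (g : Fin q) cs → not (containsColour g cs) ≡ all (λ c → not ⌊ c ≟ g ⌋) cs
not-containsColour g []       = refl
not-containsColour g (c ∷ cs) with ⌊ c ≟ g ⌋
... | true  = refl
... | false = not-containsColour g cs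

count-gray-free : ∀ {q} (g : Fin q) n →
                  count (not ∘ containsColour g ∘ toList) (allVecs q n) ≡ (q ∸ 1) ^ n
count-gray-free {q} g n = begin
  count (not ∘ containsColour g ∘ toList) (allVecs q n)           ≡⟨ count-ext (not-containsColour g ∘ toList) (allVecs q n) ⟩
  count (all (λ c → not ⌊ c ≟ g ⌋) ∘ toList) (allVecs q n)        ≡⟨ count-all-allVecs _ n ⟩
  count (λ c → not ⌊ c ≟ g ⌋) (allFin q) ^ n                      ≡⟨ cong (_^ n) (count-≢-allFin g) ⟩
  (q ∸ 1) ^ n                                                     ∎
  where open ≡-Reasoning

count-wins-grayStrategy : ∀ {q} (g : Fin q) n →
                          count (wins (grayStrategy g)) (allVecs q n) + (q ∸ 1) ^ n ≡ q ^ n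
count-wins-grayStrategy {q} g n = begin
  count (wins (grayStrategy g)) (allVecs q n) + (q ∸ 1) ^ n
    ≡⟨ cong₂ _+_ (count-ext (GrayStrategy.wins-grayStrategy g) (allVecs q n)) (sym (count-gray-free g n)) ⟩
  count (containsColour g ∘ toList) (allVecs q n) + count (not ∘ containsColour g ∘ toList) (allVecs q n)
    ≡⟨ count-+-count-not _ (allVecs q n) ⟩
  length (allVecs q n)
    ≡⟨ length-allVecs q n ⟩
  q ^ n
    ∎
  where open ≡-Reasoning

-- a / (a + b) ≃ 1 − b / (a + b), cross-multiplied as ℚᵘ's _≃_ and _-_ unfold.
complement-identity : ∀ (a b : ℤ) →
  a ℤ.* (+ 1 ℤ.* (a ℤ.+ b)) ≡ (+ 1 ℤ.* (a ℤ.+ b) ℤ.+ ℤ.- b ℤ.* + 1) ℤ.* (a ℤ.+ b)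
complement-identity = solve-∀

mkℚᵘ-complement : ∀ a b d → a + b ≡ suc d → mkℚᵘ (+ a) d ≃ 1ℚᵘ ℚᵘ.- mkℚᵘ (+ b) d
mkℚᵘ-complement a b d a+b≡1+d =
  *≡* (subst (λ m → + a ℤ.* (+ 1 ℤ.* m) ≡ (+ 1 ℤ.* m ℤ.+ ℤ.- + b ℤ.* + 1) ℤ.* m)
             (trans (sym (ℤ.pos-+ a b)) (cong +_ a+b≡1+d))
             (complement-identity (+ a) (+ b)))

/-complement : ∀ a b m .{{_ : NonZero m}} → a + b ≡ m → + a / m ≡ 1ℚ - + b / m
/-complement a b (suc d) a+b≡m = toℚᵘ-injective (begin
  toℚᵘ (+ a / suc d)                                 ≈⟨ toℚᵘ-fromℚᵘ (mkℚᵘ (+ a) d) ⟩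
  mkℚᵘ (+ a) d                                       ≈⟨ mkℚᵘ-complement a b d a+b≡m ⟩
  1ℚᵘ ℚᵘ.- mkℚᵘ (+ b) d                               ≈⟨ ℚᵘ.+-congʳ 1ℚᵘ (ℚᵘ.-‿cong (ℚᵘ.≃-sym (toℚᵘ-fromℚᵘ (mkℚᵘ (+ b) d)))) ⟩
  toℚᵘ 1ℚ ℚᵘ.- toℚᵘ (+ b / suc d)                     ≈⟨ ℚᵘ.+-congʳ 1ℚᵘ (ℚᵘ.≃-sym (toℚᵘ-homo‿- (+ b / suc d))) ⟩
  toℚᵘ 1ℚ ℚᵘ.+ toℚᵘ (ℚ.- (+ b / suc d))               ≈⟨ ℚᵘ.≃-sym (toℚᵘ-homo-+ 1ℚ (ℚ.- (+ b / suc d))) ⟩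
  toℚᵘ (1ℚ - + b / suc d)                            ∎)
  where open ℚᵘ.≃-Reasoning

/-*-/ : ∀ i j m n .{{_ : NonZero m}} .{{_ : NonZero n}} →
        (i / m) ℚ.* (j / n) ≡ ((i ℤ.* j) / (m * n)) {{m*n≢0 m n}}
/-*-/ i j (suc m) (suc n) = toℚᵘ-injective (begin
  toℚᵘ ((i / suc m) ℚ.* (j / suc n))          ≈⟨ toℚᵘ-homo-* (i / suc m) (j / suc n) ⟩
  toℚᵘ (i / suc m) ℚᵘ.* toℚᵘ (j / suc n)      ≈⟨ ℚᵘ.*-cong (toℚᵘ-fromℚᵘ (mkℚᵘ i m)) (toℚᵘ-fromℚᵘ (mkℚᵘ j n)) ⟩
  mkℚᵘ i m ℚᵘ.* mkℚᵘ j n                      ≈⟨ ℚᵘ.≃-sym (toℚᵘ-fromℚᵘ (mkℚᵘ i m ℚᵘ.* mkℚᵘ j n)) ⟩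
  toℚᵘ ((i ℤ.* j) / (suc m * suc n))          ∎)
  where open ℚᵘ.≃-Reasoning

/-^ℚ : ∀ a m k .{{_ : NonZero m}} → (+ a / m) ^ℚ k ≡ (+ (a ^ k) / (m ^ k)) {{m^n≢0 m k}}
/-^ℚ a m zero    = refl
/-^ℚ a m (suc k) = begin
  (+ a / m) ℚ.* ((+ a / m) ^ℚ k)        ≡⟨ cong ((+ a / m) ℚ.*_) (/-^ℚ a m k) ⟩
  (+ a / m) ℚ.* (+ (a ^ k) / (m ^ k))   ≡⟨ /-*-/ (+ a) (+ (a ^ k)) m (m ^ k) ⟩
  (+ a ℤ.* + (a ^ k)) / (m * m ^ k)     ≡⟨ cong (_/ (m * m ^ k)) (sym (ℤ.pos-* a (a ^ k))) ⟩
  + (a ^ suc k) / (m ^ suc k)           ∎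
  where
    open ≡-Reasoning
    instance
      m^k≢0 : NonZero (m ^ k)
      m^k≢0 = m^n≢0 m k
      m^1+k≢0 : NonZero (m ^ suc k)
      m^1+k≢0 = m^n≢0 m (suc k)

theorem1 : (q n : ℕ) .{{_ : NonZero q}} → 1 < q → 1 ≤ n → (gray : Fin q) →
    prob q n (wins (grayStrategy gray)) ≡ 1ℚ - (((+ (q ∸ 1)) / q) ^ℚ n)
theorem1 q n _ _ gray = begin
  + wins# / q ^ n
    ≡⟨ /-complement wins# ((q ∸ 1) ^ n) (q ^ n) (count-wins-grayStrategy gray n) ⟩
  1ℚ - + ((q ∸ 1) ^ n) / q ^ n
    ≡⟨ cong (1ℚ -_) (sym (/-^ℚ (q ∸ 1) q n)) ⟩
  1ℚ - (+ (q ∸ 1) / q) ^ℚ n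
    ∎
  where
    open ≡-Reasoning
    wins# : ℕ
    wins# = count (wins (grayStrategy gray)) (allVecs q n)
    instance
      q^n≢0 : NonZero (q ^ n)
      q^n≢0 = m^n≢0 q n
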